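{- For integers $k\ge1$ and $N\ge k+3$, $$W_1^*(N,k)=\theta^2P_{N-2}\,W_1^*(N-1,k)+\sum_{i=k+1}^{N-1}\theta^{N-i-1}\,T_1(i-1,k)\,B(i-1,N-i-1)\,(P_{N-i-1})!,$$ with initial conditions $W_1^*(k+1,k)=0$ and $W_1^*(k+2,k)=(P_k)!$.
   Context: Let $\theta>0$. $\mathrm{inv}(\pi)$ is the number of pairs $i<j$ with $\pi_i>\pi_j$. $P_n=1+\theta+\cdots+\theta^{n-1}$, $(P_n)!=P_n\cdots P_1$, $(P_0)!=1$. $B(n,m)=\sum\theta^{\#\{(a,b):a\in\Pi_1,b\in\Pi_2,a>b\}}$ over all ordered partitions $(\Pi_1,\Pi_2)$ of $\{1,\dots,n+m\}$ with $|\Pi_1|=n,|\Pi_2|=m$. For $\pi\in S_n$, position $i$ is a left-to-right maximum if $\pi_i>\pi_j$ for all $j<i$. The strategy $S^1_k$ rejects the first $k$ candidates and then accepts the first subsequent left-to-right maximum (if any). $\pi\in S_n$ is $k$-pickable if $S^1_k$ makes a selection, and $k$-winnable if $S^1_k$ selects a position holding value $n-1$. $T_1(n,k)=\sum_{\pi\in S_n\text{ not }k\text{ -pickable}}\theta^{\mathrm{inv}(\pi)}$ and $W_1^*(n,k)=\sum_{\pi\in S_n\ k\text{ -winnable}}\theta^{\mathrm{inv}(\pi)}$. -}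

module Defs where

open import Data.Nat using (_≟_; ℕ; zero; suc; _+_; _∸_; _<ᵇ_; _≤ᵇ_; _≡ᵇ_; _⊔_)
open import Data.Bool using (Bool; true; false; if_then_else_; _∧_; not)
open import Data.List using (List; []; _∷_; map; concatMap; foldr; filter; upTo; length)
open import Data.Maybe using (Maybe; just; nothing)
open import Algebra.Bundles using (CommutativeSemiring)

-- Permutations of {1,…,n}, in one-line notation π = [π₁,…,πₙ].

insertions : ℕ → List ℕ → List (List ℕ)
insertions x []       = (x ∷ []) ∷ []
insertions x (y ∷ ys) = (x ∷ y ∷ ys) ∷ map (y ∷_) (insertions x ys)

perms : ℕ → List (List ℕ)
perms zero    = [] ∷ []
perms (suc n) = concatMap (insertions (suc n)) (perms n)

countLess : ℕ → List ℕ → ℕ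
countLess x []       = 0
countLess x (y ∷ ys) = (if y <ᵇ x then 1 else 0) + countLess x ys

inv : List ℕ → ℕ
inv []       = 0
inv (x ∷ xs) = countLess x xs + inv xs

-- Strategy S¹_k: reject the first k candidates, then accept the first
-- later left-to-right maximum.  Returns the value at the selected
-- position, if any.  `i` is the 0-based index (position i+1), `m` the
-- maximum of the values seen so far (0 initially; values are ≥ 1, so
-- position 1 is a left-to-right maximum).

selectFrom : ℕ → ℕ → ℕ → List ℕ → Maybe ℕ
selectFrom k i m []       = nothing
selectFrom k i m (x ∷ xs) =
  if (k ≤ᵇ i) ∧ (m <ᵇ x) then just x else selectFrom k (suc i) (m ⊔ x) xs

select : ℕ → List ℕ → Maybe ℕ
select k π = selectFrom k 0 0 π

pickableᵇ : ℕ → List ℕ → Bool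
pickableᵇ k π with select k π
... | just _  = true
... | nothing = false

winnableᵇ : ℕ → ℕ → List ℕ → Bool
winnableᵇ n k π with select k π
... | just v  = v ≡ᵇ (n ∸ 1)
... | nothing = false

-- Ordered partitions (Π₁,Π₂) of {1,…,n+m}: a Boolean word b₁…b_{n+m},
-- with j ∈ Π₁ iff bⱼ = true.

words : ℕ → List (List Bool)
words zero    = [] ∷ []
words (suc n) = concatMap (λ w → (true ∷ w) ∷ (false ∷ w) ∷ []) (words n)

countTrue : List Bool → ℕ
countTrue []           = 0
countTrue (true ∷ bs)  = suc (countTrue bs)
countTrue (false ∷ bs) = countTrue bs

-- #{(a,b) : a ∈ Π₁, b ∈ Π₂, a > b}
crossPairs : List Bool → ℕ
crossPairs []           = 0
crossPairs (true ∷ bs)  = crossPairs bs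
crossPairs (false ∷ bs) = countTrue bs + crossPairs bs

-- The θ-weighted quantities, with θ in a commutative semiring R
-- (all quantities are polynomials in θ with ℕ coefficients).

module Weighted {c ℓ} (R : CommutativeSemiring c ℓ)
                (θ : CommutativeSemiring.Carrier R) where
  open CommutativeSemiring R
    renaming (_+_ to _⊕_; _*_ to _⊗_)

  sumL : List Carrier → Carrier
  sumL = foldr _⊕_ 0#

  θ^ : ℕ → Carrier
  θ^ zero    = 1#
  θ^ (suc n) = θ ⊗ θ^ n

  P : ℕ → Carrier
  P n = sumL (map θ^ (upTo n))

  Pfact : ℕ → Carrier
  Pfact zero    = 1#
  Pfact (suc n) = P (suc n) ⊗ Pfact n

  B : ℕ → ℕ → Carrier
  B n m = sumL (map (λ w → θ^ (crossPairs w))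
                    (filter (λ w → countTrue w ≟ n) (words (n + m))))

  T₁ : ℕ → ℕ → Carrier
  T₁ n k = sumL (map (λ π → if not (pickableᵇ k π) then θ^ (inv π) else 0#)
                     (perms n))

  W₁* : ℕ → ℕ → Carrier
  W₁* n k = sumL (map (λ π → if winnableᵇ n k π then θ^ (inv π) else 0#)
                      (perms n))

  sumRange : ℕ → ℕ → (ℕ → Carrier) → Carrier
  sumRange a b f = sumL (map (λ j → f (a + j)) (upTo (suc b ∸ a)))

module Submission where

-- Insert the values n+1, n+2, … one at a time into permutations of smaller size:
-- inserting a new maximum at position p adds exactly (length − p) inversions, so
-- sums of θ^inv factor into weights of insertion positions.  For S¹_k, a new
-- maximum inserted into a prefix is picked iff it lands at a position ≥ k, and
-- π ∈ S_N is winnable iff N−1 sits at some position s ≥ k whose prefix is not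
-- k-pickable and N comes after it.  The sum of θ^inv over permutations of
-- length s+e whose s-prefix is unpickable is T₁(s,k)·B(s,e)·(P_e)!, which gives
--   W₁*(k+t+2,k) = Σ_{j+e=t} θ^e P_{e+1} T₁(k+j,k) B(k+j,e) (P_e)!,
-- and splitting P_{e+1} = 1 + θ P_e yields the recurrence.

open import Algebra.Bundles using (CommutativeSemiring)
open import Data.Bool using (Bool; true; false; if_then_else_; _∧_; not; T)
open import Data.Bool.Properties using (∧-zeroʳ; ∧-conicalˡ)
open import Data.Empty using (⊥-elim)
open import Data.List using (List; []; _∷_; map; concatMap; filter; length; applyUpTo; take; _++_)
open import Data.List.Properties using (map-applyUpTo; take-all)
open import Data.List.Relation.Unary.All as All using (All; []; _∷_)
import Data.List.Relation.Unary.All.Properties as All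
open import Data.Maybe using (Maybe; just; nothing)
open import Data.Nat using (ℕ; zero; suc; _∸_; _≤_; _<_; _<ᵇ_; _≤ᵇ_; _≡ᵇ_; _⊔_; z≤n; s≤s)
import Data.Nat as ℕ
import Data.Nat.Properties as ℕₚ
open import Data.Product using (_×_; _,_)
open import Data.Unit using (tt)
open import Function using (_∘_)
open import Relation.Binary.PropositionalEquality as ≡ using (_≡_; _≢_; refl; cong; cong₂)
open import Relation.Nullary using (Dec; does)

open import Defs

<ᵇ-true : ∀ {m n} → m < n → (m <ᵇ n) ≡ true
<ᵇ-true {zero}  (s≤s _)       = refl
<ᵇ-true {suc m} (s≤s (s≤s p)) = <ᵇ-true {m} (s≤s p)

<ᵇ-false : ∀ {m n} → n ≤ m → (m <ᵇ n) ≡ false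
<ᵇ-false {m}     {zero}  _       = refl
<ᵇ-false {suc m} {suc n} (s≤s p) = <ᵇ-false p

<ᵇ-suc : ∀ m n → (m <ᵇ suc n) ≡ not (n <ᵇ m)
<ᵇ-suc zero    zero    = refl
<ᵇ-suc zero    (suc n) = refl
<ᵇ-suc (suc m) zero    = refl
<ᵇ-suc (suc m) (suc n) = <ᵇ-suc m n

≤ᵇ≡not<ᵇ : ∀ m n → (m ≤ᵇ n) ≡ not (n <ᵇ m)
≤ᵇ≡not<ᵇ zero    zero    = refl
≤ᵇ≡not<ᵇ zero    (suc n) = refl
≤ᵇ≡not<ᵇ (suc m) zero    = refl
≤ᵇ≡not<ᵇ (suc m) (suc n) = <ᵇ-suc m n

≤ᵇ-true : ∀ {m n} → m ≤ n → (m ≤ᵇ n) ≡ true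
≤ᵇ-true {m} {n} m≤n = ≡.trans (≤ᵇ≡not<ᵇ m n) (cong not (<ᵇ-false m≤n))

≤ᵇ-false : ∀ {m n} → n < m → (m ≤ᵇ n) ≡ false
≤ᵇ-false {m} {n} n<m = ≡.trans (≤ᵇ≡not<ᵇ m n) (cong not (<ᵇ-true n<m))

≡ᵇ-refl : ∀ n → (n ≡ᵇ n) ≡ true
≡ᵇ-refl zero    = refl
≡ᵇ-refl (suc n) = ≡ᵇ-refl n

≢⇒≡ᵇ-false : ∀ {m n} → m ≢ n → (m ≡ᵇ n) ≡ false
≢⇒≡ᵇ-false {zero}  {zero}  m≢n = ⊥-elim (m≢n refl)
≢⇒≡ᵇ-false {zero}  {suc n} _   = refl
≢⇒≡ᵇ-false {suc m} {zero}  _   = refl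
≢⇒≡ᵇ-false {suc m} {suc n} m≢n = ≢⇒≡ᵇ-false (m≢n ∘ cong suc)

-- Permutations built by inserting a new maximum

insertAt : ℕ → ℕ → List ℕ → List ℕ
insertAt zero    x ys       = x ∷ ys
insertAt (suc p) x []       = x ∷ []
insertAt (suc p) x (y ∷ ys) = y ∷ insertAt p x ys

insertions≡applyUpTo-insertAt : ∀ x σ →
  insertions x σ ≡ applyUpTo (λ p → insertAt p x σ) (suc (length σ))
insertions≡applyUpTo-insertAt x []       = refl
insertions≡applyUpTo-insertAt x (y ∷ ys) = cong ((x ∷ y ∷ ys) ∷_) (begin
  map (y ∷_) (insertions x ys)
    ≡⟨ cong (map (y ∷_)) (insertions≡applyUpTo-insertAt x ys) ⟩
  map (y ∷_) (applyUpTo (λ p → insertAt p x ys) (suc (length ys)))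
    ≡⟨ map-applyUpTo (λ p → insertAt p x ys) (y ∷_) (suc (length ys)) ⟩
  applyUpTo (λ p → y ∷ insertAt p x ys) (suc (length ys)) ∎)
  where open ≡.≡-Reasoning

length-insertAt : ∀ p x σ → length (insertAt p x σ) ≡ suc (length σ)
length-insertAt zero    x σ       = refl
length-insertAt (suc p) x []      = refl
length-insertAt (suc p) x (y ∷ σ) = cong suc (length-insertAt p x σ)

All-insertAt : ∀ {P : ℕ → Set} p x σ → P x → All P σ → All P (insertAt p x σ)
All-insertAt zero    x σ       px ps        = px ∷ ps
All-insertAt (suc p) x []      px ps        = px ∷ []
All-insertAt (suc p) x (y ∷ σ) px (py ∷ ps) = py ∷ All-insertAt p x σ px ps

Bounded : ℕ → List ℕ → Set
Bounded n σ = length σ ≡ n × All (_< suc n) σ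

perms-bounded : ∀ n → All (Bounded n) (perms n)
perms-bounded zero    = (refl , []) ∷ []
perms-bounded (suc n) = All.concat⁺ (All.map⁺ (All.map insertions-bounded (perms-bounded n)))
  where
  insertions-bounded : ∀ {σ} → Bounded n σ → All (Bounded (suc n)) (insertions (suc n) σ)
  insertions-bounded {σ} (len , bnd) rewrite insertions≡applyUpTo-insertAt (suc n) σ =
    All.applyUpTo⁺₂ _ _ λ p →
      ≡.trans (length-insertAt p (suc n) σ) (cong suc len) ,
      All-insertAt p (suc n) σ (ℕₚ.n<1+n (suc n)) (All.map ℕₚ.m<n⇒m<1+n bnd)

countLess-all : ∀ x σ → All (_< x) σ → countLess x σ ≡ length σ
countLess-all x []      []         = refl
countLess-all x (y ∷ σ) (y<x ∷ ps) rewrite <ᵇ-true y<x = cong suc (countLess-all x σ ps)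

countLess-insertAt : ∀ y p x σ → y < x → countLess y (insertAt p x σ) ≡ countLess y σ
countLess-insertAt y zero    x σ       y<x rewrite <ᵇ-false (ℕₚ.<⇒≤ y<x) = refl
countLess-insertAt y (suc p) x []      y<x rewrite <ᵇ-false (ℕₚ.<⇒≤ y<x) = refl
countLess-insertAt y (suc p) x (z ∷ σ) y<x =
  cong ((if z <ᵇ y then 1 else 0) ℕ.+_) (countLess-insertAt y p x σ y<x)

inv-insertAt : ∀ p x σ → All (_< x) σ → p ≤ length σ →
  inv (insertAt p x σ) ≡ inv σ ℕ.+ (length σ ∸ p)
inv-insertAt zero    x σ       ps       _ rewrite countLess-all x σ ps = ℕₚ.+-comm (length σ) (inv σ)
inv-insertAt (suc p) x (y ∷ σ) (y<x ∷ ps) (s≤s p≤)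
  rewrite countLess-insertAt y p x σ y<x | inv-insertAt p x σ ps p≤ =
  ≡.sym (ℕₚ.+-assoc (countLess y σ) (inv σ) (length σ ∸ p))

-- The strategy S¹_k on permutations with a newly inserted maximum

unpicked : Maybe ℕ → Bool
unpicked nothing  = true
unpicked (just _) = false

picks : ℕ → Maybe ℕ → Bool
picks a (just v) = v ≡ᵇ a
picks a nothing  = false

not-pickable≡unpicked : ∀ k π → not (pickableᵇ k π) ≡ unpicked (select k π)
not-pickable≡unpicked k π with select k π
... | just _  = refl
... | nothing = refl

winnable≡picks : ∀ n k π → winnableᵇ n k π ≡ picks (n ∸ 1) (select k π)
winnable≡picks n k π with select k π
... | just _  = refl
... | nothing = refl

selectFrom-dominated : ∀ k i m τ → All (_≤ m) τ → selectFrom k i m τ ≡ nothing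
selectFrom-dominated k i m []      []         = refl
selectFrom-dominated k i m (y ∷ τ) (y≤m ∷ ps)
  rewrite <ᵇ-false {m} {y} y≤m | ∧-zeroʳ (k ≤ᵇ i) | ℕₚ.m≥n⇒m⊔n≡m y≤m =
  selectFrom-dominated k (suc i) m τ ps

-- A new maximum inside the prefix is picked iff its position is not rejected;
-- either way nothing after it is picked, since it exceeds every value.
unpicked-take-insertAt : ∀ k i m x s p σ → All (_< x) σ → m < x → p ≤ length σ →
  unpicked (selectFrom k i m (take s (insertAt p x σ)))
    ≡ (if p <ᵇ s then (i ℕ.+ p <ᵇ k) else unpicked (selectFrom k i m (take s σ)))
unpicked-take-insertAt k i m x zero    p       σ       _ _ _ = refl
unpicked-take-insertAt k i m x (suc s) zero    σ       ps m<x _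
  rewrite <ᵇ-true m<x | ℕₚ.+-identityʳ i | ≤ᵇ≡not<ᵇ k i with i <ᵇ k
... | false = refl
... | true  rewrite ℕₚ.m≤n⇒m⊔n≡n (ℕₚ.<⇒≤ m<x)
                  | selectFrom-dominated k (suc i) x (take s σ) (All.take⁺ s (All.map ℕₚ.<⇒≤ ps)) = refl
unpicked-take-insertAt k i m x (suc s) (suc p) (y ∷ σ) (y<x ∷ ps) m<x (s≤s p≤)
  with (k ≤ᵇ i) ∧ (m <ᵇ y) in picked
... | true
  rewrite <ᵇ-false {i ℕ.+ suc p} {k}
            (ℕₚ.≤-trans (ℕₚ.≤ᵇ⇒≤ k i (≡.subst T (≡.sym (∧-conicalˡ _ _ picked)) tt))
                        (ℕₚ.m≤m+n i (suc p)))
  with p <ᵇ s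
...   | true  = refl
...   | false = refl
unpicked-take-insertAt k i m x (suc s) (suc p) (y ∷ σ) (y<x ∷ ps) m<x (s≤s p≤) | false
  rewrite ℕₚ.+-suc i p =
  unpicked-take-insertAt k (suc i) (m ⊔ y) x s p σ ps (ℕₚ.⊔-lub m<x y<x) p≤

¬picks-insertAt-max : ∀ k i m a b τ p → All (_≤ m) τ → m < b → b ≢ a →
  picks a (selectFrom k i m (insertAt p b τ)) ≡ false
¬picks-insertAt-max k i m a b τ zero ps m<b b≢a rewrite <ᵇ-true m<b with k ≤ᵇ i
... | true  = ≢⇒≡ᵇ-false b≢a
... | false rewrite ℕₚ.m≤n⇒m⊔n≡n (ℕₚ.<⇒≤ m<b)
                  | selectFrom-dominated k (suc i) b τ
                      (All.map (λ y≤m → ℕₚ.≤-trans y≤m (ℕₚ.<⇒≤ m<b)) ps) = refl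
¬picks-insertAt-max k i m a b []      (suc p) ps m<b b≢a = ¬picks-insertAt-max k i m a b [] zero ps m<b b≢a
¬picks-insertAt-max k i m a b (y ∷ τ) (suc p) (y≤m ∷ ps) m<b b≢a
  rewrite <ᵇ-false {m} {y} y≤m | ∧-zeroʳ (k ≤ᵇ i) | ℕₚ.m≥n⇒m⊔n≡m y≤m =
  ¬picks-insertAt-max k (suc i) m a b τ p ps m<b b≢a

picks-insertAt-insertAt : ∀ k i m a b s p τ → All (_< a) τ → a < b → m < a → s ≤ length τ →
  picks a (selectFrom k i m (insertAt p b (insertAt s a τ)))
    ≡ (s <ᵇ p) ∧ ((k ≤ᵇ i ℕ.+ s) ∧ unpicked (selectFrom k i m (take s τ)))
picks-insertAt-insertAt k i m a b s zero τ ps a<b m<a s≤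
  rewrite <ᵇ-true (ℕₚ.<-trans m<a a<b) with k ≤ᵇ i
... | true  = ≢⇒≡ᵇ-false (ℕₚ.>⇒≢ a<b)
... | false rewrite ℕₚ.m≤n⇒m⊔n≡n (ℕₚ.<⇒≤ (ℕₚ.<-trans m<a a<b))
                  | selectFrom-dominated k (suc i) b (insertAt s a τ)
                      (All-insertAt s a τ (ℕₚ.<⇒≤ a<b)
                        (All.map (λ y<a → ℕₚ.<⇒≤ (ℕₚ.<-trans y<a a<b)) ps)) = refl
picks-insertAt-insertAt k i m a b zero (suc p) τ ps a<b m<a s≤
  rewrite <ᵇ-true m<a | ℕₚ.+-identityʳ i with k ≤ᵇ i
... | true  rewrite ≡ᵇ-refl a = refl
... | false rewrite ℕₚ.m≤n⇒m⊔n≡n (ℕₚ.<⇒≤ m<a) =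
  ¬picks-insertAt-max k (suc i) a a b τ p (All.map ℕₚ.<⇒≤ ps) a<b (ℕₚ.>⇒≢ a<b)
picks-insertAt-insertAt k i m a b (suc s) (suc p) (y ∷ τ) (y<a ∷ ps) a<b m<a (s≤s s≤)
  with (k ≤ᵇ i) ∧ (m <ᵇ y)
... | true
  rewrite ≢⇒≡ᵇ-false (ℕₚ.<⇒≢ y<a) | ∧-zeroʳ (k ≤ᵇ i ℕ.+ suc s) | ∧-zeroʳ (s <ᵇ p) = refl
... | false rewrite ℕₚ.+-suc i s =
  picks-insertAt-insertAt k (suc i) (m ⊔ y) a b s p τ ps a<b (ℕₚ.⊔-lub m<a y<a) s≤

module Recurrence {c ℓ} (R : CommutativeSemiring c ℓ) (θ : CommutativeSemiring.Carrier R) where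
  open CommutativeSemiring R renaming (refl to ≈-refl)
  open Weighted R θ
  open import Algebra.Solver.Ring.NaturalCoefficients.Default R
  open import Relation.Binary.Reasoning.Setoid setoid

  when : Bool → Carrier → Carrier
  when b x = if b then x else 0#

  when-cong : ∀ b {x y} → x ≈ y → when b x ≈ when b y
  when-cong true  x≈y = x≈y
  when-cong false _   = ≈-refl

  when-0# : ∀ b → when b 0# ≈ 0#
  when-0# true  = ≈-refl
  when-0# false = ≈-refl

  when-*ˡ : ∀ b a x → when b (a * x) ≈ a * when b x
  when-*ˡ true  a x = ≈-refl
  when-*ˡ false a x = sym (zeroʳ a)

  when-*ʳ : ∀ b x a → when b (x * a) ≈ when b x * a
  when-*ʳ true  x a = ≈-refl
  when-*ʳ false x a = sym (zeroˡ a)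

  when-if : ∀ c a b y x →
    when (if c then a else b) (y * x) ≈ when (c ∧ a) y * x + when b (when (not c) y * x)
  when-if true  a b y x = sym (begin
    when a y * x + when b (0# * x) ≈⟨ +-congˡ (trans (when-cong b (zeroˡ x)) (when-0# b)) ⟩
    when a y * x + 0#               ≈⟨ +-identityʳ _ ⟩
    when a y * x                    ≈⟨ when-*ʳ a y x ⟨
    when a (y * x)                  ∎)
  when-if false a b y x = sym (trans (+-congʳ (zeroˡ x)) (+-identityˡ _))

  when-∧-∧ : ∀ a b c z y x → when (a ∧ (b ∧ c)) (z * (y * x)) ≈ (when b y * when c x) * when a z
  when-∧-∧ true  true  true  z y x = solve 3 (λ z y x → z :* (y :* x) := (y :* x) :* z) ≈-refl z y x
  when-∧-∧ true  true  false z y x = solve 2 (λ z y → con 0 := (y :* con 0) :* z) ≈-refl z y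
  when-∧-∧ true  false c     z y x = solve 2 (λ z w → con 0 := (con 0 :* w) :* z) ≈-refl z (when c x)
  when-∧-∧ false b     c     z y x = solve 1 (λ w → con 0 := w :* con 0) ≈-refl (when b y * when c x)

  +-interchange : ∀ a b c d → (a + b) + (c + d) ≈ (a + c) + (b + d)
  +-interchange = solve 4 (λ a b c d → (a :+ b) :+ (c :+ d) := (a :+ c) :+ (b :+ d)) ≈-refl

  module _ {a} {A : Set a} where
    sumL-++ : (f : A → Carrier) (xs ys : List A) →
      sumL (map f (xs ++ ys)) ≈ sumL (map f xs) + sumL (map f ys)
    sumL-++ f []       ys = sym (+-identityˡ _)
    sumL-++ f (x ∷ xs) ys = trans (+-congˡ (sumL-++ f xs ys)) (sym (+-assoc _ _ _))

    sumL-cong : {f g : A → Carrier} (xs : List A) → (∀ x → f x ≈ g x) →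
      sumL (map f xs) ≈ sumL (map g xs)
    sumL-cong []       f≈g = ≈-refl
    sumL-cong (x ∷ xs) f≈g = +-cong (f≈g x) (sumL-cong xs f≈g)

    sumL-cong-All : {f g : A → Carrier} (xs : List A) → All (λ x → f x ≈ g x) xs →
      sumL (map f xs) ≈ sumL (map g xs)
    sumL-cong-All []       []           = ≈-refl
    sumL-cong-All (x ∷ xs) (fx≈gx ∷ ps) = +-cong fx≈gx (sumL-cong-All xs ps)

    sumL-*ˡ : (a : Carrier) (f : A → Carrier) (xs : List A) →
      sumL (map (λ x → a * f x) xs) ≈ a * sumL (map f xs)
    sumL-*ˡ a f []       = sym (zeroʳ a)
    sumL-*ˡ a f (x ∷ xs) = trans (+-congˡ (sumL-*ˡ a f xs)) (sym (distribˡ a _ _))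

    sumL-+ : (f g : A → Carrier) (xs : List A) →
      sumL (map (λ x → f x + g x) xs) ≈ sumL (map f xs) + sumL (map g xs)
    sumL-+ f g []       = sym (+-identityˡ 0#)
    sumL-+ f g (x ∷ xs) = trans (+-congˡ (sumL-+ f g xs)) (+-interchange _ _ _ _)

    sumL-filter : ∀ {p} {Q : A → Set p} (f : A → Carrier) (Q? : ∀ x → Dec (Q x)) (xs : List A) →
      sumL (map f (filter Q? xs)) ≈ sumL (map (λ x → when (does (Q? x)) (f x)) xs)
    sumL-filter f Q? []       = ≈-refl
    sumL-filter f Q? (x ∷ xs) with does (Q? x)
    ... | true  = +-congˡ (sumL-filter f Q? xs)
    ... | false = trans (sumL-filter f Q? xs) (sym (+-identityˡ _))

    sumL-concatMap : ∀ {b} {A′ : Set b} (f : A → Carrier) (g : A′ → List A) (xs : List A′) →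
      sumL (map f (concatMap g xs)) ≈ sumL (map (λ x → sumL (map f (g x))) xs)
    sumL-concatMap f g []       = ≈-refl
    sumL-concatMap f g (x ∷ xs) =
      trans (sumL-++ f (g x) (concatMap g xs)) (+-congˡ (sumL-concatMap f g xs))

  sumUpTo : ℕ → (ℕ → Carrier) → Carrier
  sumUpTo n f = sumL (applyUpTo f n)

  sumUpTo-cong : ∀ n {f g : ℕ → Carrier} → (∀ i → i < n → f i ≈ g i) → sumUpTo n f ≈ sumUpTo n g
  sumUpTo-cong zero    f≈g = ≈-refl
  sumUpTo-cong (suc n) f≈g = +-cong (f≈g 0 (s≤s z≤n)) (sumUpTo-cong n (λ i i<n → f≈g (suc i) (s≤s i<n)))

  sumUpTo-*ˡ : ∀ n a f → sumUpTo n (λ i → a * f i) ≈ a * sumUpTo n f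
  sumUpTo-*ˡ zero    a f = sym (zeroʳ a)
  sumUpTo-*ˡ (suc n) a f = trans (+-congˡ (sumUpTo-*ˡ n a (f ∘ suc))) (sym (distribˡ a _ _))

  sumUpTo-+ : ∀ n f g → sumUpTo n (λ i → f i + g i) ≈ sumUpTo n f + sumUpTo n g
  sumUpTo-+ zero    f g = sym (+-identityˡ 0#)
  sumUpTo-+ (suc n) f g = trans (+-congˡ (sumUpTo-+ n (f ∘ suc) (g ∘ suc))) (+-interchange _ _ _ _)

  sumUpTo-zero : ∀ n f → (∀ i → i < n → f i ≈ 0#) → sumUpTo n f ≈ 0#
  sumUpTo-zero zero    f f≈0 = ≈-refl
  sumUpTo-zero (suc n) f f≈0 = trans
    (+-cong (f≈0 0 (s≤s z≤n)) (sumUpTo-zero n (f ∘ suc) (λ i i<n → f≈0 (suc i) (s≤s i<n))))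
    (+-identityˡ 0#)

  sumUpTo-split : ∀ a b f → sumUpTo (a ℕ.+ b) f ≈ sumUpTo a f + sumUpTo b (λ i → f (a ℕ.+ i))
  sumUpTo-split zero    b f = sym (+-identityˡ _)
  sumUpTo-split (suc a) b f = trans (+-congˡ (sumUpTo-split a b (f ∘ suc))) (sym (+-assoc _ _ _))

  sumL-sumUpTo : ∀ {a} {A : Set a} n (h : A → ℕ → Carrier) (xs : List A) →
    sumL (map (λ x → sumUpTo n (h x)) xs) ≈ sumUpTo n (λ i → sumL (map (λ x → h x i) xs))
  sumL-sumUpTo n h []       = sym (sumUpTo-zero n (λ _ → 0#) (λ _ _ → ≈-refl))
  sumL-sumUpTo n h (x ∷ xs) = trans (+-congˡ (sumL-sumUpTo n h xs)) (sym (sumUpTo-+ n (h x) _))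

  sumRange≈sumUpTo : ∀ a b n (f : ℕ → Carrier) → suc b ∸ a ≡ n →
    sumRange a b f ≈ sumUpTo n (λ j → f (a ℕ.+ j))
  sumRange≈sumUpTo a b n f refl = reflexive (cong sumL (map-applyUpTo (λ i → i) (λ j → f (a ℕ.+ j)) n))

  antidiagonal : ℕ → (ℕ → ℕ → Carrier) → Carrier
  antidiagonal zero    h = h 0 0
  antidiagonal (suc t) h = h 0 (suc t) + antidiagonal t (λ j e → h (suc j) e)

  sumUpTo≈antidiagonal : ∀ t (g : ℕ → Carrier) (h : ℕ → ℕ → Carrier) →
    (∀ j e → j ℕ.+ e ≡ t → g j ≈ h j e) → sumUpTo (suc t) g ≈ antidiagonal t h
  sumUpTo≈antidiagonal zero    g h g≈h = trans (+-identityʳ _) (g≈h 0 0 refl)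
  sumUpTo≈antidiagonal (suc t) g h g≈h = +-cong (g≈h 0 (suc t) refl)
    (sumUpTo≈antidiagonal t (g ∘ suc) (λ j e → h (suc j) e) (λ j e eq → g≈h (suc j) e (cong suc eq)))

  antidiagonal-cong : ∀ t {h h′ : ℕ → ℕ → Carrier} →
    (∀ j e → j ℕ.+ e ≡ t → h j e ≈ h′ j e) → antidiagonal t h ≈ antidiagonal t h′
  antidiagonal-cong zero    h≈h′ = h≈h′ 0 0 refl
  antidiagonal-cong (suc t) h≈h′ =
    +-cong (h≈h′ 0 (suc t) refl) (antidiagonal-cong t (λ j e eq → h≈h′ (suc j) e (cong suc eq)))

  antidiagonal-*ˡ : ∀ t a h → antidiagonal t (λ j e → a * h j e) ≈ a * antidiagonal t h
  antidiagonal-*ˡ zero    a h = ≈-refl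
  antidiagonal-*ˡ (suc t) a h = trans (+-congˡ (antidiagonal-*ˡ t a _)) (sym (distribˡ a _ _))

  antidiagonal-+ : ∀ t h h′ →
    antidiagonal t (λ j e → h j e + h′ j e) ≈ antidiagonal t h + antidiagonal t h′
  antidiagonal-+ zero    h h′ = ≈-refl
  antidiagonal-+ (suc t) h h′ = trans (+-congˡ (antidiagonal-+ t _ _)) (+-interchange _ _ _ _)

  antidiagonal-suc : ∀ t h → antidiagonal (suc t) h ≈ antidiagonal t (λ j e → h j (suc e)) + h (suc t) 0
  antidiagonal-suc zero    h = ≈-refl
  antidiagonal-suc (suc t) h =
    trans (+-congˡ (antidiagonal-suc t (λ j e → h (suc j) e))) (sym (+-assoc _ _ _))

  sumUpTo-when-≤ᵇ : ∀ a b (f : ℕ → Carrier) →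
    sumUpTo (a ℕ.+ b) (λ i → when (a ≤ᵇ i) (f i)) ≈ sumUpTo b (λ j → f (a ℕ.+ j))
  sumUpTo-when-≤ᵇ a b f = begin
    sumUpTo (a ℕ.+ b) (λ i → when (a ≤ᵇ i) (f i))
      ≈⟨ sumUpTo-split a b (λ i → when (a ≤ᵇ i) (f i)) ⟩
    sumUpTo a (λ i → when (a ≤ᵇ i) (f i)) + sumUpTo b (λ j → when (a ≤ᵇ a ℕ.+ j) (f (a ℕ.+ j)))
      ≈⟨ +-cong (sumUpTo-zero a _ (λ i i<a → reflexive (cong (λ c → when c (f i)) (≤ᵇ-false i<a))))
                (sumUpTo-cong b (λ j _ →
                  reflexive (cong (λ c → when c (f (a ℕ.+ j))) (≤ᵇ-true (ℕₚ.m≤m+n a j))))) ⟩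
    0# + sumUpTo b (λ j → f (a ℕ.+ j))
      ≈⟨ +-identityˡ _ ⟩
    sumUpTo b (λ j → f (a ℕ.+ j)) ∎

  -- θ-integers, insertion weights and θ-binomials

  θ^-+ : ∀ a b → θ^ (a ℕ.+ b) ≈ θ^ a * θ^ b
  θ^-+ zero    b = sym (*-identityˡ _)
  θ^-+ (suc a) b = trans (*-congˡ (θ^-+ a b)) (sym (*-assoc _ _ _))

  P≡sumUpTo : ∀ n → P n ≡ sumUpTo n θ^
  P≡sumUpTo n = cong sumL (map-applyUpTo (λ i → i) θ^ n)

  P-suc : ∀ n → P (suc n) ≈ 1# + θ * P n
  P-suc n = begin
    P (suc n)                    ≡⟨ P≡sumUpTo (suc n) ⟩
    1# + sumUpTo n (λ i → θ * θ^ i) ≈⟨ +-congˡ (sumUpTo-*ˡ n θ θ^) ⟩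
    1# + θ * sumUpTo n θ^        ≡⟨ cong (λ z → 1# + θ * z) (≡.sym (P≡sumUpTo n)) ⟩
    1# + θ * P n                 ∎

  P-1 : P 1 ≈ 1#
  P-1 = trans (P-suc 0) (trans (+-congˡ (zeroʳ θ)) (+-identityʳ 1#))

  P-+ : ∀ a b → P (a ℕ.+ b) ≈ P a + θ^ a * P b
  P-+ zero    b = solve 1 (λ p → p := con 0 :+ con 1 :* p) ≈-refl (P b)
  P-+ (suc a) b = begin
    P (suc (a ℕ.+ b))              ≈⟨ P-suc (a ℕ.+ b) ⟩
    1# + θ * P (a ℕ.+ b)           ≈⟨ +-congˡ (*-congˡ (P-+ a b)) ⟩
    1# + θ * (P a + θ^ a * P b)
      ≈⟨ solve 4 (λ t pa ta pb → con 1 :+ t :* (pa :+ ta :* pb) := (con 1 :+ t :* pa) :+ (t :* ta) :* pb)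
                 ≈-refl θ (P a) (θ^ a) (P b) ⟩
    (1# + θ * P a) + θ^ (suc a) * P b ≈⟨ +-congʳ (P-suc a) ⟨
    P (suc a) + θ^ (suc a) * P b   ∎

  P-suc-θ^ : ∀ n → P (suc n) ≈ P n + θ^ n
  P-suc-θ^ n = begin
    P (suc n)         ≡⟨ cong P (ℕₚ.+-comm 1 n) ⟩
    P (n ℕ.+ 1)       ≈⟨ P-+ n 1 ⟩
    P n + θ^ n * P 1  ≈⟨ +-congˡ (trans (*-congˡ P-1) (*-identityʳ _)) ⟩
    P n + θ^ n        ∎

  -- Inserting a new maximum into a word of length m at position p ≤ m creates
  -- m ∸ p inversions; this is the total weight of the positions allowed by c.
  insertionWeight : ℕ → (ℕ → Bool) → Carrier
  insertionWeight m c = sumUpTo (suc m) (λ p → when (c p) (θ^ (m ∸ p)))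

  insertionWeight-suc : ∀ m c → insertionWeight (suc m) c ≈ θ * insertionWeight m c + when (c (suc m)) 1#
  insertionWeight-suc zero c = begin
    when (c 0) (θ * 1#) + (when (c 1) 1# + 0#) ≈⟨ +-congʳ (when-*ˡ (c 0) θ 1#) ⟩
    θ * when (c 0) 1# + (when (c 1) 1# + 0#)
      ≈⟨ solve 3 (λ t a b → t :* a :+ (b :+ con 0) := t :* (a :+ con 0) :+ b)
                 ≈-refl θ (when (c 0) 1#) (when (c 1) 1#) ⟩
    θ * (when (c 0) 1# + 0#) + when (c 1) 1# ∎
  insertionWeight-suc (suc m) c = begin
    when (c 0) (θ * θ^ (suc m)) + insertionWeight (suc m) (c ∘ suc)
      ≈⟨ +-cong (when-*ˡ (c 0) θ _) (insertionWeight-suc m (c ∘ suc)) ⟩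
    θ * when (c 0) (θ^ (suc m)) + (θ * insertionWeight m (c ∘ suc) + when (c (suc (suc m))) 1#)
      ≈⟨ solve 4 (λ t a b d → t :* a :+ (t :* b :+ d) := t :* (a :+ b) :+ d) ≈-refl θ _ _ _ ⟩
    θ * insertionWeight (suc m) c + when (c (suc (suc m))) 1# ∎

  insertionWeight-none : ∀ m → insertionWeight m (λ _ → false) ≈ 0#
  insertionWeight-none m = sumUpTo-zero (suc m) _ (λ _ _ → ≈-refl)

  insertionWeight-all : ∀ m → insertionWeight m (λ _ → true) ≈ P (suc m)
  insertionWeight-all zero    = ≈-refl
  insertionWeight-all (suc m) = begin
    insertionWeight (suc m) (λ _ → true) ≈⟨ insertionWeight-suc m (λ _ → true) ⟩
    θ * insertionWeight m (λ _ → true) + 1# ≈⟨ +-congʳ (*-congˡ (insertionWeight-all m)) ⟩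
    θ * P (suc m) + 1#                   ≈⟨ +-comm _ _ ⟩
    1# + θ * P (suc m)                   ≈⟨ P-suc (suc m) ⟨
    P (suc (suc m))                      ∎

  insertionWeight-≥ : ∀ s e → insertionWeight (s ℕ.+ e) (λ p → not (p <ᵇ s)) ≈ P (suc e)
  insertionWeight-≥ zero    e = insertionWeight-all e
  insertionWeight-≥ (suc s) e = trans (+-identityˡ _) (insertionWeight-≥ s e)

  insertionWeight-> : ∀ s e → insertionWeight (suc (s ℕ.+ e)) (s <ᵇ_) ≈ P (suc e)
  insertionWeight-> zero    e = trans (+-identityˡ _) (insertionWeight-all e)
  insertionWeight-> (suc s) e = trans (+-identityˡ _) (insertionWeight-> s e)

  insertionWeight-+ : ∀ s e c → (∀ p → s < p → c p ≡ false) →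
    insertionWeight (s ℕ.+ e) c ≈ θ^ e * insertionWeight s c
  insertionWeight-+ s zero c _ =
    trans (reflexive (cong (λ z → insertionWeight z c) (ℕₚ.+-identityʳ s))) (sym (*-identityˡ _))
  insertionWeight-+ s (suc e) c c>s = begin
    insertionWeight (s ℕ.+ suc e) c   ≡⟨ cong (λ z → insertionWeight z c) (ℕₚ.+-suc s e) ⟩
    insertionWeight (suc (s ℕ.+ e)) c ≈⟨ insertionWeight-suc (s ℕ.+ e) c ⟩
    θ * insertionWeight (s ℕ.+ e) c + when (c (suc (s ℕ.+ e))) 1#
      ≡⟨ cong (λ b → θ * insertionWeight (s ℕ.+ e) c + when b 1#) (c>s _ (s≤s (ℕₚ.m≤m+n s e))) ⟩
    θ * insertionWeight (s ℕ.+ e) c + 0# ≈⟨ +-identityʳ _ ⟩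
    θ * insertionWeight (s ℕ.+ e) c     ≈⟨ *-congˡ (insertionWeight-+ s e c c>s) ⟩
    θ * (θ^ e * insertionWeight s c)    ≈⟨ *-assoc _ _ _ ⟨
    θ^ (suc e) * insertionWeight s c    ∎

  -- B indexed by the total word length, so that the first letter can be peeled off.
  Bʷ : ℕ → ℕ → Carrier
  Bʷ n L = sumL (map (λ w → when (does (countTrue w ℕ.≟ n)) (θ^ (crossPairs w))) (words L))

  B≈Bʷ : ∀ n m → B n m ≈ Bʷ n (n ℕ.+ m)
  B≈Bʷ n m = sumL-filter (λ w → θ^ (crossPairs w)) (λ w → countTrue w ℕ.≟ n) (words (n ℕ.+ m))

  when-≟ : ∀ a n (f : ℕ → Carrier) → when (does (a ℕ.≟ n)) (f a) ≈ when (does (a ℕ.≟ n)) (f n)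
  when-≟ a n f with a ≡ᵇ n in eq
  ... | true  = reflexive (cong (λ z → f z) (ℕₚ.≡ᵇ⇒≡ a n (≡.subst T (≡.sym eq) tt)))
  ... | false = ≈-refl

  Bʷ-first-letter : ∀ n L → Bʷ n (suc L) ≈
    sumL (map (λ w → when (does (suc (countTrue w) ℕ.≟ n)) (θ^ (crossPairs w))
                   + when (does (countTrue w ℕ.≟ n)) (θ^ (countTrue w ℕ.+ crossPairs w))) (words L))
  Bʷ-first-letter n L = trans (sumL-concatMap _ (λ w → (true ∷ w) ∷ (false ∷ w) ∷ []) (words L))
    (sumL-cong (words L) (λ w → +-congˡ (+-identityʳ _)))

  Bʷ-zero : ∀ L → Bʷ 0 L ≈ 1#
  Bʷ-zero zero    = +-identityʳ 1#
  Bʷ-zero (suc L) = begin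
    Bʷ 0 (suc L) ≈⟨ Bʷ-first-letter 0 L ⟩
    _            ≈⟨ sumL-cong (words L) (λ w → trans (+-identityˡ _)
                      (when-≟ (countTrue w) 0 (λ a → θ^ (a ℕ.+ crossPairs w)))) ⟩
    Bʷ 0 L       ≈⟨ Bʷ-zero L ⟩
    1#           ∎

  Bʷ-suc : ∀ n L → Bʷ (suc n) (suc L) ≈ Bʷ n L + θ^ (suc n) * Bʷ (suc n) L
  Bʷ-suc n L = begin
    Bʷ (suc n) (suc L) ≈⟨ Bʷ-first-letter (suc n) L ⟩
    _                  ≈⟨ sumL-cong (words L) (λ w → +-congˡ (second w)) ⟩
    _                  ≈⟨ sumL-+ _ _ (words L) ⟩
    _                  ≈⟨ +-congˡ (sumL-*ˡ (θ^ (suc n)) _ (words L)) ⟩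
    Bʷ n L + θ^ (suc n) * Bʷ (suc n) L ∎
    where
    second : ∀ w → when (does (countTrue w ℕ.≟ suc n)) (θ^ (countTrue w ℕ.+ crossPairs w))
                 ≈ θ^ (suc n) * when (does (countTrue w ℕ.≟ suc n)) (θ^ (crossPairs w))
    second w = trans (when-≟ (countTrue w) (suc n) (λ a → θ^ (a ℕ.+ crossPairs w)))
                (trans (when-cong _ (θ^-+ (suc n) (crossPairs w))) (when-*ˡ _ _ _))

  Bʷ-> : ∀ L n → L < n → Bʷ n L ≈ 0#
  Bʷ-> zero    (suc n) _         = +-identityʳ 0#
  Bʷ-> (suc L) (suc n) (s≤s L<n) = begin
    Bʷ (suc n) (suc L)                 ≈⟨ Bʷ-suc n L ⟩
    Bʷ n L + θ^ (suc n) * Bʷ (suc n) L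
      ≈⟨ +-cong (Bʷ-> L n L<n) (*-congˡ (Bʷ-> L (suc n) (ℕₚ.m<n⇒m<1+n L<n))) ⟩
    0# + θ^ (suc n) * 0#               ≈⟨ solve 1 (λ t → con 0 :+ t :* con 0 := con 0) ≈-refl _ ⟩
    0#                                 ∎

  Bʷ-diagonal : ∀ n → Bʷ n n ≈ 1#
  Bʷ-diagonal zero    = Bʷ-zero 0
  Bʷ-diagonal (suc n) = begin
    Bʷ (suc n) (suc n)                 ≈⟨ Bʷ-suc n n ⟩
    Bʷ n n + θ^ (suc n) * Bʷ (suc n) n ≈⟨ +-cong (Bʷ-diagonal n) (*-congˡ (Bʷ-> n (suc n) (ℕₚ.n<1+n n))) ⟩
    1# + θ^ (suc n) * 0#               ≈⟨ solve 1 (λ t → con 1 :+ t :* con 0 := con 1) ≈-refl _ ⟩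
    1#                                 ∎

  B-zeroˡ : ∀ m → B 0 m ≈ 1#
  B-zeroˡ m = trans (B≈Bʷ 0 m) (Bʷ-zero m)

  B-zeroʳ : ∀ n → B n 0 ≈ 1#
  B-zeroʳ n = trans (B≈Bʷ n 0) (trans (reflexive (cong (Bʷ n) (ℕₚ.+-identityʳ n))) (Bʷ-diagonal n))

  B-pascalˡ : ∀ n m → B (suc n) (suc m) ≈ B n (suc m) + θ^ (suc n) * B (suc n) m
  B-pascalˡ n m = begin
    B (suc n) (suc m)                               ≈⟨ B≈Bʷ (suc n) (suc m) ⟩
    Bʷ (suc n) (suc (n ℕ.+ suc m))                  ≈⟨ Bʷ-suc n (n ℕ.+ suc m) ⟩
    Bʷ n (n ℕ.+ suc m) + θ^ (suc n) * Bʷ (suc n) (n ℕ.+ suc m)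
      ≡⟨ cong (λ z → Bʷ n (n ℕ.+ suc m) + θ^ (suc n) * Bʷ (suc n) z) (ℕₚ.+-suc n m) ⟩
    Bʷ n (n ℕ.+ suc m) + θ^ (suc n) * Bʷ (suc n) (suc n ℕ.+ m)
      ≈⟨ +-cong (B≈Bʷ n (suc m)) (*-congˡ (B≈Bʷ (suc n) m)) ⟨
    B n (suc m) + θ^ (suc n) * B (suc n) m          ∎

  B-oneʳ : ∀ n → B n 1 ≈ P (suc n)
  B-oneʳ zero    = trans (B-zeroˡ 1) (sym P-1)
  B-oneʳ (suc n) = begin
    B (suc n) 1                          ≈⟨ B-pascalˡ n 0 ⟩
    B n 1 + θ^ (suc n) * B (suc n) 0
      ≈⟨ +-cong (B-oneʳ n) (trans (*-congˡ (B-zeroʳ (suc n))) (*-identityʳ _)) ⟩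
    P (suc n) + θ^ (suc n)               ≈⟨ P-suc-θ^ (suc n) ⟨
    P (suc (suc n))                      ∎

  B-oneˡ : ∀ m → B 1 m ≈ P (suc m)
  B-oneˡ zero    = trans (B-zeroʳ 1) (sym P-1)
  B-oneˡ (suc m) = begin
    B 1 (suc m)               ≈⟨ B-pascalˡ 0 m ⟩
    B 0 (suc m) + θ^ 1 * B 1 m ≈⟨ +-cong (B-zeroˡ (suc m)) (*-cong (*-identityʳ θ) (B-oneˡ m)) ⟩
    1# + θ * P (suc m)        ≈⟨ P-suc (suc m) ⟨
    P (suc (suc m))           ∎

  B-pascalʳ : ∀ n m → B (suc n) (suc m) ≈ B (suc n) m + θ^ (suc m) * B n (suc m)
  B-pascalʳ zero m = begin
    B 1 (suc m)                        ≈⟨ B-oneˡ (suc m) ⟩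
    P (suc (suc m))                    ≈⟨ P-suc-θ^ (suc m) ⟩
    P (suc m) + θ^ (suc m)             ≈⟨ +-cong (B-oneˡ m) (trans (*-congˡ (B-zeroˡ (suc m))) (*-identityʳ _)) ⟨
    B 1 m + θ^ (suc m) * B 0 (suc m)   ∎
  B-pascalʳ (suc n) zero = begin
    B (suc (suc n)) 1                  ≈⟨ B-oneʳ (suc (suc n)) ⟩
    P (suc (suc (suc n)))              ≈⟨ P-suc (suc (suc n)) ⟩
    1# + θ * P (suc (suc n))
      ≈⟨ +-cong (B-zeroʳ (suc (suc n))) (*-cong (*-identityʳ θ) (B-oneʳ (suc n))) ⟨
    B (suc (suc n)) 0 + θ^ 1 * B (suc n) 1 ∎
  B-pascalʳ (suc n) (suc m) = begin
    B (suc (suc n)) (suc (suc m))      ≈⟨ B-pascalˡ (suc n) (suc m) ⟩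
    B (suc n) (suc (suc m)) + θ^ (suc (suc n)) * B (suc (suc n)) (suc m)
      ≈⟨ +-cong (B-pascalʳ n (suc m)) (*-congˡ (B-pascalʳ (suc n) m)) ⟩
    (X + (θ * tm) * Y) + (θ * tn) * (Z + tm * X)
      ≈⟨ solve 6 (λ t tn tm X Y Z → (X :+ (t :* tm) :* Y) :+ (t :* tn) :* (Z :+ tm :* X)
                                  := (X :+ (t :* tn) :* Z) :+ (t :* tm) :* (Y :+ tn :* X)) ≈-refl θ tn tm X Y Z ⟩
    (X + (θ * tn) * Z) + (θ * tm) * (Y + tn * X)
      ≈⟨ +-cong (B-pascalˡ (suc n) m) (*-congˡ (B-pascalˡ n (suc m))) ⟨
    B (suc (suc n)) (suc m) + θ^ (suc (suc m)) * B (suc n) (suc (suc m)) ∎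
    where
    tn = θ^ (suc n)
    tm = θ^ (suc m)
    X = B (suc n) (suc m)
    Y = B n (suc (suc m))
    Z = B (suc (suc n)) m

  Pfact-+ : ∀ a b → Pfact a * Pfact b * B a b ≈ Pfact (a ℕ.+ b)
  Pfact-+ zero    b    = trans (*-congˡ (B-zeroˡ b)) (solve 1 (λ x → con 1 :* x :* con 1 := x) ≈-refl (Pfact b))
  Pfact-+ (suc a) zero = begin
    Pfact (suc a) * 1# * B (suc a) 0 ≈⟨ *-cong (*-identityʳ _) (B-zeroʳ (suc a)) ⟩
    Pfact (suc a) * 1#               ≈⟨ *-identityʳ _ ⟩
    Pfact (suc a)                    ≡⟨ cong Pfact (ℕₚ.+-identityʳ (suc a)) ⟨
    Pfact (suc a ℕ.+ 0)              ∎
  Pfact-+ (suc a) (suc b) = begin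
    (pa * fa) * (pb * fb) * B (suc a) (suc b)            ≈⟨ *-congˡ (B-pascalˡ a b) ⟩
    (pa * fa) * (pb * fb) * (B a (suc b) + θ^ (suc a) * B (suc a) b)
      ≈⟨ solve 7 (λ pa fa pb fb x ta y → (pa :* fa) :* (pb :* fb) :* (x :+ ta :* y)
                   := pa :* (fa :* (pb :* fb) :* x) :+ ta :* pb :* ((pa :* fa) :* fb :* y))
                 ≈-refl pa fa pb fb (B a (suc b)) (θ^ (suc a)) (B (suc a) b) ⟩
    pa * (fa * Pfact (suc b) * B a (suc b)) + θ^ (suc a) * pb * (Pfact (suc a) * fb * B (suc a) b)
      ≈⟨ +-cong (*-congˡ (Pfact-+ a (suc b))) (*-congˡ (Pfact-+ (suc a) b)) ⟩
    pa * Pfact (a ℕ.+ suc b) + θ^ (suc a) * pb * Pfact (suc (a ℕ.+ b))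
      ≡⟨ cong (λ z → pa * Pfact z + θ^ (suc a) * pb * Pfact (suc (a ℕ.+ b))) (ℕₚ.+-suc a b) ⟩
    pa * Pfact (suc (a ℕ.+ b)) + θ^ (suc a) * pb * Pfact (suc (a ℕ.+ b))
      ≈⟨ solve 4 (λ pa t pb f → pa :* f :+ t :* pb :* f := (pa :+ t :* pb) :* f) ≈-refl pa (θ^ (suc a)) pb _ ⟩
    (pa + θ^ (suc a) * pb) * Pfact (suc (a ℕ.+ b))       ≈⟨ *-congʳ (P-+ (suc a) (suc b)) ⟨
    P (suc a ℕ.+ suc b) * Pfact (suc (a ℕ.+ b))
      ≡⟨ cong (λ z → P (suc z) * Pfact (suc (a ℕ.+ b))) (ℕₚ.+-suc a b) ⟩
    Pfact (suc (suc (a ℕ.+ b)))                          ≡⟨ cong (Pfact ∘ suc) (ℕₚ.+-suc a b) ⟨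
    Pfact (suc a ℕ.+ suc b)                              ∎
    where
    pa = P (suc a)
    fa = Pfact a
    pb = P (suc b)
    fb = Pfact b

  B-sucʳ-P : ∀ s e → B s (suc e) * P (suc e) ≈ P (suc (s ℕ.+ e)) * B s e
  B-sucʳ-P zero e = trans (*-congʳ (B-zeroˡ (suc e))) (trans (*-comm _ _) (*-congˡ (sym (B-zeroˡ e))))
  B-sucʳ-P (suc s) zero = begin
    B (suc s) 1 * P 1                  ≈⟨ *-cong (B-oneʳ (suc s)) P-1 ⟩
    P (suc (suc s)) * 1#
      ≈⟨ *-cong (reflexive (cong (P ∘ suc ∘ suc) (ℕₚ.+-identityʳ s))) (B-zeroʳ (suc s)) ⟨
    P (suc (suc s ℕ.+ 0)) * B (suc s) 0 ∎
  B-sucʳ-P (suc s) (suc e) = begin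
    B (suc s) (suc (suc e)) * P (suc (suc e))   ≈⟨ *-congʳ (B-pascalʳ s (suc e)) ⟩
    (X + (θ * te) * W) * P (suc (suc e))        ≈⟨ distribʳ _ _ _ ⟩
    X * P (suc (suc e)) + (θ * te) * W * P (suc (suc e))
      ≈⟨ +-cong (*-congˡ (P-suc-θ^ (suc e))) (*-assoc _ _ _) ⟩
    X * (P (suc e) + te) + (θ * te) * (W * P (suc (suc e)))
      ≈⟨ +-cong (distribˡ _ _ _)
                (*-congˡ (trans (B-sucʳ-P s (suc e)) (*-congʳ (reflexive (cong (P ∘ suc) (ℕₚ.+-suc s e)))))) ⟩
    (X * P (suc e) + X * te) + (θ * te) * (Q * Z)
      ≈⟨ +-congʳ (+-cong (B-sucʳ-P (suc s) e) (*-congʳ (B-pascalˡ s e))) ⟩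
    (Q * Y + (Z + ts * Y) * te) + (θ * te) * (Q * Z)
      ≈⟨ solve 6 (λ t te ts Q Y Z → (Q :* Y :+ (Z :+ ts :* Y) :* te) :+ (t :* te) :* (Q :* Z)
                                  := (Q :+ ts :* te) :* Y :+ te :* ((con 1 :+ t :* Q) :* Z)) ≈-refl θ te ts Q Y Z ⟩
    (Q + ts * te) * Y + te * ((1# + θ * Q) * Z)
      ≈⟨ +-cong (*-congʳ (trans (+-congˡ (sym θ^-s+e)) (sym (P-suc-θ^ (suc (suc (s ℕ.+ e)))))))
                (*-congˡ (*-congʳ (sym (P-suc (suc (suc (s ℕ.+ e))))))) ⟩
    Q′ * Y + te * (Q′ * Z)
      ≈⟨ solve 4 (λ c Y te Z → c :* Y :+ te :* (c :* Z) := c :* (Y :+ te :* Z)) ≈-refl Q′ Y te Z ⟩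
    Q′ * (Y + te * Z)
      ≈⟨ *-cong (reflexive (cong (P ∘ suc ∘ suc) (≡.sym (ℕₚ.+-suc s e)))) (sym (B-pascalʳ s e)) ⟩
    P (suc (suc s ℕ.+ suc e)) * B (suc s) (suc e) ∎
    where
    te = θ^ (suc e)
    ts = θ^ (suc s)
    X = B (suc s) (suc e)
    W = B s (suc (suc e))
    Y = B (suc s) e
    Z = B s (suc e)
    Q = P (suc (suc (s ℕ.+ e)))
    Q′ = P (suc (suc (suc (s ℕ.+ e))))
    θ^-s+e : θ^ (suc (suc (s ℕ.+ e))) ≈ ts * te
    θ^-s+e = trans (reflexive (cong (θ^ ∘ suc) (≡.sym (ℕₚ.+-suc s e)))) (θ^-+ (suc s) (suc e))

  antidiagonal-P-split : ∀ t c (G : ℕ → ℕ → Carrier) →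
    (∀ j e → j ℕ.+ e ≡ t → G j (suc e) ≈ c * G j e) →
    antidiagonal (suc t) (λ j e → θ^ e * P (suc e) * G j e)
      ≈ (θ^ 2 * c) * antidiagonal t (λ j e → θ^ e * P (suc e) * G j e)
        + antidiagonal (suc t) (λ j e → θ^ e * G j e)
  antidiagonal-P-split t c G G-suc = begin
    antidiagonal (suc t) (λ j e → θ^ e * P (suc e) * G j e)
      ≈⟨ antidiagonal-cong (suc t) (λ j e _ → split-P j e) ⟩
    antidiagonal (suc t) (λ j e → θ^ e * G j e + θ^ (suc e) * P e * G j e)
      ≈⟨ antidiagonal-+ (suc t) (λ j e → θ^ e * G j e) (λ j e → θ^ (suc e) * P e * G j e) ⟩
    A + antidiagonal (suc t) (λ j e → θ^ (suc e) * P e * G j e)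
      ≈⟨ +-congˡ (antidiagonal-suc t (λ j e → θ^ (suc e) * P e * G j e)) ⟩
    A + (antidiagonal t (λ j e → θ^ (suc (suc e)) * P (suc e) * G j (suc e)) + θ^ 1 * P 0 * G (suc t) 0)
      ≈⟨ +-congˡ (+-cong (antidiagonal-cong t shift) (trans (*-congʳ (zeroʳ _)) (zeroˡ _))) ⟩
    A + (antidiagonal t (λ j e → θ^ 2 * c * (θ^ e * P (suc e) * G j e)) + 0#)
      ≈⟨ +-congˡ (trans (+-identityʳ _) (antidiagonal-*ˡ t (θ^ 2 * c) _)) ⟩
    A + θ^ 2 * c * antidiagonal t (λ j e → θ^ e * P (suc e) * G j e)
      ≈⟨ +-comm _ _ ⟩
    θ^ 2 * c * antidiagonal t (λ j e → θ^ e * P (suc e) * G j e) + A ∎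
    where
    A = antidiagonal (suc t) (λ j e → θ^ e * G j e)
    split-P : ∀ j e → θ^ e * P (suc e) * G j e ≈ θ^ e * G j e + θ^ (suc e) * P e * G j e
    split-P j e = trans (*-congʳ (*-congˡ (P-suc e)))
      (solve 4 (λ te t p g → te :* (con 1 :+ t :* p) :* g := te :* g :+ (t :* te) :* p :* g)
             ≈-refl (θ^ e) θ (P e) (G j e))
    shift : ∀ j e → j ℕ.+ e ≡ t →
      θ^ (suc (suc e)) * P (suc e) * G j (suc e) ≈ θ^ 2 * c * (θ^ e * P (suc e) * G j e)
    shift j e j+e≡t = trans (*-congˡ (G-suc j e j+e≡t))
      (solve 5 (λ t te p c g → (t :* (t :* te)) :* p :* (c :* g) := (t :* (t :* con 1) :* c) :* (te :* p :* g))
             ≈-refl θ (θ^ e) (P (suc e)) c (G j e))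

  sumL-insertions : (f : List ℕ → Carrier) (x : ℕ) (σ : List ℕ) →
    sumL (map f (insertions x σ)) ≈ sumUpTo (suc (length σ)) (λ p → f (insertAt p x σ))
  sumL-insertions f x σ = reflexive (≡.trans (cong (sumL ∘ map f) (insertions≡applyUpTo-insertAt x σ))
    (cong sumL (map-applyUpTo (λ p → insertAt p x σ) f (suc (length σ)))))

  θ^-inv-insertAt : ∀ p x σ → All (_< x) σ → p ≤ length σ →
    θ^ (inv (insertAt p x σ)) ≈ θ^ (length σ ∸ p) * θ^ (inv σ)
  θ^-inv-insertAt p x σ σ<x p≤ =
    trans (reflexive (cong θ^ (inv-insertAt p x σ σ<x p≤))) (trans (θ^-+ (inv σ) _) (*-comm _ _))

  -- Unpickable prefixes and winnable permutations for S¹_k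

  module _ (k : ℕ) where

    unpickedWeight : ℕ → List ℕ → Carrier
    unpickedWeight s σ = when (unpicked (select k (take s σ))) (θ^ (inv σ))

    Unpicked : ℕ → ℕ → Carrier
    Unpicked m s = sumL (map (unpickedWeight s) (perms m))

    rejectedIn : ℕ → ℕ → Bool
    rejectedIn s p = (p <ᵇ s) ∧ (p <ᵇ k)

    outside : ℕ → ℕ → Bool
    outside s p = not (p <ᵇ s)

    insertions-unpicked : ∀ m s σ → Bounded m σ →
      sumL (map (unpickedWeight s) (insertions (suc m) σ))
        ≈ insertionWeight m (rejectedIn s) * θ^ (inv σ) + insertionWeight m (outside s) * unpickedWeight s σ
    insertions-unpicked _ s σ (refl , σ≤) = begin
      sumL (map (unpickedWeight s) (insertions (suc m) σ))
        ≈⟨ sumL-insertions (unpickedWeight s) (suc m) σ ⟩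
      sumUpTo (suc m) (λ p → unpickedWeight s (insertAt p (suc m) σ))
        ≈⟨ sumUpTo-cong (suc m) (λ p p≤m → at p (ℕₚ.≤-pred p≤m)) ⟩
      sumUpTo (suc m) (λ p → weight (rejectedIn s) p * x + u * weight (outside s) p)
        ≈⟨ sumUpTo-+ (suc m) (λ p → weight (rejectedIn s) p * x) (λ p → u * weight (outside s) p) ⟩
      sumUpTo (suc m) (λ p → weight (rejectedIn s) p * x) + sumUpTo (suc m) (λ p → u * weight (outside s) p)
        ≈⟨ +-cong (trans (sumUpTo-cong (suc m) (λ p _ → *-comm (weight (rejectedIn s) p) x))
                         (trans (sumUpTo-*ˡ (suc m) x (weight (rejectedIn s))) (*-comm x _)))
                  (trans (sumUpTo-*ˡ (suc m) u (weight (outside s))) (*-comm u _)) ⟩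
      insertionWeight m (rejectedIn s) * x + insertionWeight m (outside s) * u ∎
      where
      m = length σ
      x = θ^ (inv σ)
      u = unpickedWeight s σ
      weight : (ℕ → Bool) → ℕ → Carrier
      weight c p = when (c p) (θ^ (m ∸ p))
      at : ∀ p → p ≤ m →
        unpickedWeight s (insertAt p (suc m) σ) ≈ weight (rejectedIn s) p * x + u * weight (outside s) p
      at p p≤m = begin
        unpickedWeight s (insertAt p (suc m) σ)
          ≡⟨ cong (λ b → when b (θ^ (inv (insertAt p (suc m) σ))))
                  (unpicked-take-insertAt k 0 0 (suc m) s p σ σ≤ (s≤s z≤n) p≤m) ⟩
        when (if p <ᵇ s then p <ᵇ k else unpicked (select k (take s σ))) (θ^ (inv (insertAt p (suc m) σ)))
          ≈⟨ when-cong _ (θ^-inv-insertAt p (suc m) σ σ≤ p≤m) ⟩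
        when (if p <ᵇ s then p <ᵇ k else unpicked (select k (take s σ))) (θ^ (m ∸ p) * x)
          ≈⟨ when-if (p <ᵇ s) (p <ᵇ k) _ (θ^ (m ∸ p)) x ⟩
        weight (rejectedIn s) p * x + when (unpicked (select k (take s σ))) (weight (outside s) p * x)
          ≈⟨ +-congˡ (trans (when-*ˡ _ _ x) (*-comm _ _)) ⟩
        weight (rejectedIn s) p * x + u * weight (outside s) p ∎

    Unpicked-suc : ∀ m s → Unpicked (suc m) s
      ≈ insertionWeight m (rejectedIn s) * Unpicked m 0 + insertionWeight m (outside s) * Unpicked m s
    Unpicked-suc m s = begin
      Unpicked (suc m) s
        ≈⟨ sumL-concatMap (unpickedWeight s) (insertions (suc m)) (perms m) ⟩
      sumL (map (λ σ → sumL (map (unpickedWeight s) (insertions (suc m) σ))) (perms m))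
        ≈⟨ sumL-cong-All (perms m) (All.map (λ {σ} → insertions-unpicked m s σ) (perms-bounded m)) ⟩
      sumL (map (λ σ → wᵣ * θ^ (inv σ) + wₒ * unpickedWeight s σ) (perms m))
        ≈⟨ sumL-+ (λ σ → wᵣ * θ^ (inv σ)) (λ σ → wₒ * unpickedWeight s σ) (perms m) ⟩
      _ ≈⟨ +-cong (sumL-*ˡ wᵣ (λ σ → θ^ (inv σ)) (perms m)) (sumL-*ˡ wₒ (unpickedWeight s) (perms m)) ⟩
      wᵣ * Unpicked m 0 + wₒ * Unpicked m s ∎
      where
      wᵣ = insertionWeight m (rejectedIn s)
      wₒ = insertionWeight m (outside s)

    -- Every empty prefix is unpickable, so this is the θ-count of all of S_m.
    Unpicked-zero : ∀ m → Unpicked m 0 ≈ Pfact m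
    Unpicked-zero zero    = +-identityʳ 1#
    Unpicked-zero (suc m) = begin
      Unpicked (suc m) 0 ≈⟨ Unpicked-suc m 0 ⟩
      insertionWeight m (λ _ → false) * Unpicked m 0 + insertionWeight m (λ _ → true) * Unpicked m 0
        ≈⟨ +-cong (*-congʳ (insertionWeight-none m)) (*-cong (insertionWeight-all m) (Unpicked-zero m)) ⟩
      0# * Unpicked m 0 + P (suc m) * Pfact m ≈⟨ trans (+-congʳ (zeroˡ _)) (+-identityˡ _) ⟩
      Pfact (suc m) ∎

    Unpicked-diagonal≈T₁ : ∀ s → Unpicked s s ≈ T₁ s k
    Unpicked-diagonal≈T₁ s = sumL-cong-All (perms s) (All.map whole-prefix (perms-bounded s))
      where
      whole-prefix : ∀ {σ} → Bounded s σ → unpickedWeight s σ ≈ when (not (pickableᵇ k σ)) (θ^ (inv σ))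
      whole-prefix {σ} (len , _) = reflexive (cong (λ b → when b (θ^ (inv σ)))
        (≡.trans (cong (unpicked ∘ select k) (take-all s σ (ℕₚ.≤-reflexive len))) (≡.sym (not-pickable≡unpicked k σ))))

    Unpicked-diagonal : ∀ s → Unpicked (suc s) (suc s) ≈ insertionWeight s (rejectedIn (suc s)) * Pfact s
    Unpicked-diagonal s = begin
      Unpicked (suc s) (suc s) ≈⟨ Unpicked-suc s (suc s) ⟩
      insertionWeight s (rejectedIn (suc s)) * Unpicked s 0 + insertionWeight s (outside (suc s)) * Unpicked s (suc s)
        ≈⟨ +-cong (*-congˡ (Unpicked-zero s)) (*-congʳ (sumUpTo-zero (suc s) _ (λ p p≤s →
             reflexive (cong (λ b → when (not b) (θ^ (s ∸ p))) (<ᵇ-true p≤s))))) ⟩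
      insertionWeight s (rejectedIn (suc s)) * Pfact s + 0# * Unpicked s (suc s)
        ≈⟨ trans (+-congˡ (zeroˡ _)) (+-identityʳ _) ⟩
      insertionWeight s (rejectedIn (suc s)) * Pfact s ∎

    Unpicked-rejected : ∀ s → s ≤ k → Unpicked s s ≈ Pfact s
    Unpicked-rejected zero    _   = Unpicked-zero 0
    Unpicked-rejected (suc s) s<k = begin
      Unpicked (suc s) (suc s)                         ≈⟨ Unpicked-diagonal s ⟩
      insertionWeight s (rejectedIn (suc s)) * Pfact s
        ≈⟨ *-congʳ (trans (sumUpTo-cong (suc s) all-rejected) (insertionWeight-all s)) ⟩
      P (suc s) * Pfact s                              ∎
      where
      all-rejected : ∀ p → p < suc s → when (rejectedIn (suc s) p) (θ^ (s ∸ p)) ≈ θ^ (s ∸ p)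
      all-rejected p p≤s = reflexive (cong₂ (λ a b → when (a ∧ b) (θ^ (s ∸ p)))
        (<ᵇ-true p≤s) (<ᵇ-true (ℕₚ.<-≤-trans p≤s s<k)))

    rejectedIn-beyond : ∀ s p → s < p → rejectedIn (suc s) p ≡ false
    rejectedIn-beyond s p (s≤s s≤p) = cong (_∧ (p <ᵇ k)) (<ᵇ-false s≤p)

    Unpicked-+ : ∀ s e → Unpicked (s ℕ.+ e) s ≈ Unpicked s s * B s e * Pfact e
    Unpicked-+ s zero = begin
      Unpicked (s ℕ.+ 0) s       ≡⟨ cong (λ z → Unpicked z s) (ℕₚ.+-identityʳ s) ⟩
      Unpicked s s               ≈⟨ solve 1 (λ x → x := x :* con 1 :* con 1) ≈-refl (Unpicked s s) ⟩
      Unpicked s s * 1# * 1#     ≈⟨ *-congʳ (*-congˡ (B-zeroʳ s)) ⟨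
      Unpicked s s * B s 0 * Pfact 0 ∎
    Unpicked-+ zero (suc e) = begin
      Unpicked (suc e) 0                         ≈⟨ Unpicked-zero (suc e) ⟩
      Pfact (suc e)                              ≈⟨ solve 1 (λ x → x := con 1 :* con 1 :* x) ≈-refl _ ⟩
      1# * 1# * Pfact (suc e)                    ≈⟨ *-congʳ (*-cong (Unpicked-zero 0) (B-zeroˡ (suc e))) ⟨
      Unpicked 0 0 * B 0 (suc e) * Pfact (suc e) ∎
    Unpicked-+ (suc s) (suc e) = begin
      Unpicked (suc s ℕ.+ suc e) (suc s)  ≡⟨ cong (λ z → Unpicked (suc z) (suc s)) (ℕₚ.+-suc s e) ⟩
      Unpicked (suc (suc s ℕ.+ e)) (suc s) ≈⟨ Unpicked-suc (suc s ℕ.+ e) (suc s) ⟩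
      insertionWeight (suc s ℕ.+ e) (rejectedIn (suc s)) * Unpicked (suc s ℕ.+ e) 0
        + insertionWeight (suc s ℕ.+ e) (outside (suc s)) * Unpicked (suc s ℕ.+ e) (suc s)
        ≈⟨ +-cong (*-cong rejected (Unpicked-zero (suc s ℕ.+ e)))
                  (*-cong (insertionWeight-≥ (suc s) e)
                          (trans (Unpicked-+ (suc s) e) (*-congʳ (*-congʳ (Unpicked-diagonal s))))) ⟩
      (te * w) * Pfact (suc s ℕ.+ e) + pe * ((w * fs) * b₁ * fe)
        ≈⟨ +-congʳ (*-congˡ (sym (trans (Pfact-+ s (suc e)) (reflexive (cong Pfact (ℕₚ.+-suc s e)))))) ⟩
      (te * w) * (fs * (pe * fe) * b₂) + pe * ((w * fs) * b₁ * fe)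
        ≈⟨ solve 7 (λ te w fs pe fe b₁ b₂ → (te :* w) :* (fs :* (pe :* fe) :* b₂) :+ pe :* ((w :* fs) :* b₁ :* fe)
                                          := (w :* fs) :* (b₁ :+ te :* b₂) :* (pe :* fe)) ≈-refl te w fs pe fe b₁ b₂ ⟩
      (w * fs) * (b₁ + te * b₂) * (pe * fe)
        ≈⟨ *-congʳ (*-cong (Unpicked-diagonal s) (B-pascalʳ s e)) ⟨
      Unpicked (suc s) (suc s) * B (suc s) (suc e) * Pfact (suc e) ∎
      where
      te = θ^ (suc e)
      w = insertionWeight s (rejectedIn (suc s))
      pe = P (suc e)
      fs = Pfact s
      fe = Pfact e
      b₁ = B (suc s) e
      b₂ = B s (suc e)
      rejected : insertionWeight (suc s ℕ.+ e) (rejectedIn (suc s)) ≈ te * w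
      rejected = trans (reflexive (cong (λ z → insertionWeight z (rejectedIn (suc s))) (≡.sym (ℕₚ.+-suc s e))))
                       (insertionWeight-+ s (suc e) (rejectedIn (suc s)) (rejectedIn-beyond s))

    winnableWeight : ℕ → List ℕ → Carrier
    winnableWeight n π = when (winnableᵇ n k π) (θ^ (inv π))

    winnable-insertAt-insertAt : ∀ m σ s p → Bounded m σ → s ≤ m → p ≤ suc m →
      winnableWeight (suc (suc m)) (insertAt p (suc (suc m)) (insertAt s (suc m) σ))
        ≈ (when (k ≤ᵇ s) (θ^ (m ∸ s)) * unpickedWeight s σ) * when (s <ᵇ p) (θ^ (suc m ∸ p))
    winnable-insertAt-insertAt _ σ s p (refl , σ<) s≤m p≤ = begin
      when (winnableᵇ (suc (suc m)) k π) (θ^ (inv π))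
        ≡⟨ cong (λ b → when b (θ^ (inv π))) (≡.trans (winnable≡picks (suc (suc m)) k π)
             (picks-insertAt-insertAt k 0 0 (suc m) (suc (suc m)) s p σ σ< (ℕₚ.n<1+n (suc m)) (s≤s z≤n) s≤m)) ⟩
      when ((s <ᵇ p) ∧ ((k ≤ᵇ s) ∧ u)) (θ^ (inv π))
        ≈⟨ when-cong ((s <ᵇ p) ∧ ((k ≤ᵇ s) ∧ u)) θ^-inv-π ⟩
      when ((s <ᵇ p) ∧ ((k ≤ᵇ s) ∧ u)) (θ^ (suc m ∸ p) * (θ^ (m ∸ s) * θ^ (inv σ)))
        ≈⟨ when-∧-∧ (s <ᵇ p) (k ≤ᵇ s) u _ _ _ ⟩
      (when (k ≤ᵇ s) (θ^ (m ∸ s)) * unpickedWeight s σ) * when (s <ᵇ p) (θ^ (suc m ∸ p)) ∎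
      where
      m = length σ
      τ = insertAt s (suc m) σ
      π = insertAt p (suc (suc m)) τ
      u = unpicked (select k (take s σ))
      τ< : All (_< suc (suc m)) τ
      τ< = All-insertAt s (suc m) σ (ℕₚ.n<1+n (suc m)) (All.map ℕₚ.m<n⇒m<1+n σ<)
      θ^-inv-π : θ^ (inv π) ≈ θ^ (suc m ∸ p) * (θ^ (m ∸ s) * θ^ (inv σ))
      θ^-inv-π = begin
        θ^ (inv π)
          ≈⟨ θ^-inv-insertAt p (suc (suc m)) τ τ<
               (≡.subst (p ≤_) (≡.sym (length-insertAt s (suc m) σ)) p≤) ⟩
        θ^ (length τ ∸ p) * θ^ (inv τ)
          ≡⟨ cong (λ n → θ^ (n ∸ p) * θ^ (inv τ)) (length-insertAt s (suc m) σ) ⟩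
        θ^ (suc m ∸ p) * θ^ (inv τ)
          ≈⟨ *-congˡ (θ^-inv-insertAt s (suc m) σ σ< s≤m) ⟩
        θ^ (suc m ∸ p) * (θ^ (m ∸ s) * θ^ (inv σ)) ∎

    insertions²-winnable : ∀ m σ → Bounded m σ →
      sumL (map (λ τ → sumL (map (winnableWeight (suc (suc m))) (insertions (suc (suc m)) τ))) (insertions (suc m) σ))
        ≈ sumUpTo (suc m) (λ s → (when (k ≤ᵇ s) (θ^ (m ∸ s)) * unpickedWeight s σ) * insertionWeight (suc m) (s <ᵇ_))
    insertions²-winnable _ σ bounded@(refl , _) = trans (sumL-insertions _ (suc m) σ)
      (sumUpTo-cong (suc m) (λ s s≤m → at s (ℕₚ.≤-pred s≤m)))
      where
      m = length σ
      at : ∀ s → s ≤ m →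
        sumL (map (winnableWeight (suc (suc m))) (insertions (suc (suc m)) (insertAt s (suc m) σ)))
          ≈ (when (k ≤ᵇ s) (θ^ (m ∸ s)) * unpickedWeight s σ) * insertionWeight (suc m) (s <ᵇ_)
      at s s≤m = begin
        sumL (map (winnableWeight (suc (suc m))) (insertions (suc (suc m)) τ))
          ≈⟨ sumL-insertions (winnableWeight (suc (suc m))) (suc (suc m)) τ ⟩
        sumUpTo (suc (length τ)) (λ p → winnableWeight (suc (suc m)) (insertAt p (suc (suc m)) τ))
          ≡⟨ cong (λ n → sumUpTo (suc n) (λ p → winnableWeight (suc (suc m)) (insertAt p (suc (suc m)) τ)))
                  (length-insertAt s (suc m) σ) ⟩
        sumUpTo (suc (suc m)) (λ p → winnableWeight (suc (suc m)) (insertAt p (suc (suc m)) τ))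
          ≈⟨ sumUpTo-cong (suc (suc m)) (λ p p≤ →
               winnable-insertAt-insertAt m σ s p bounded s≤m (ℕₚ.≤-pred p≤)) ⟩
        sumUpTo (suc (suc m)) (λ p → w * when (s <ᵇ p) (θ^ (suc m ∸ p)))
          ≈⟨ sumUpTo-*ˡ (suc (suc m)) w (λ p → when (s <ᵇ p) (θ^ (suc m ∸ p))) ⟩
        w * insertionWeight (suc m) (s <ᵇ_) ∎
        where
        τ = insertAt s (suc m) σ
        w = when (k ≤ᵇ s) (θ^ (m ∸ s)) * unpickedWeight s σ

    -- θ-weight of the winnable π ∈ S_{m+2} with m + 1 at position s, when s ≥ k.
    secondBestAt : ℕ → ℕ → Carrier
    secondBestAt m s = θ^ (m ∸ s) * insertionWeight (suc m) (s <ᵇ_) * Unpicked m s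

    W₁*-suc-suc : ∀ m → W₁* (suc (suc m)) k ≈ sumUpTo (suc m) (λ s → when (k ≤ᵇ s) (secondBestAt m s))
    W₁*-suc-suc m = begin
      W₁* (suc (suc m)) k
        ≈⟨ sumL-concatMap (winnableWeight (suc (suc m))) (insertions (suc (suc m)))
                          (concatMap (insertions (suc m)) (perms m)) ⟩
      _ ≈⟨ sumL-concatMap _ (insertions (suc m)) (perms m) ⟩
      _ ≈⟨ sumL-cong-All (perms m) (All.map (λ {σ} → insertions²-winnable m σ) (perms-bounded m)) ⟩
      _ ≈⟨ sumL-sumUpTo (suc m) summand (perms m) ⟩
      _ ≈⟨ sumUpTo-cong (suc m) (λ s _ → gather s) ⟩
      sumUpTo (suc m) (λ s → when (k ≤ᵇ s) (secondBestAt m s)) ∎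
      where
      summand : List ℕ → ℕ → Carrier
      summand σ s = (when (k ≤ᵇ s) (θ^ (m ∸ s)) * unpickedWeight s σ) * insertionWeight (suc m) (s <ᵇ_)
      gather : ∀ s → sumL (map (λ σ → summand σ s) (perms m)) ≈ when (k ≤ᵇ s) (secondBestAt m s)
      gather s = begin
        sumL (map (λ σ → (a * unpickedWeight s σ) * e) (perms m))
          ≈⟨ sumL-cong (perms m) (λ σ →
               solve 3 (λ a u e → (a :* u) :* e := (a :* e) :* u) ≈-refl a (unpickedWeight s σ) e) ⟩
        sumL (map (λ σ → (a * e) * unpickedWeight s σ) (perms m))
          ≈⟨ sumL-*ˡ (a * e) (unpickedWeight s) (perms m) ⟩
        (a * e) * Unpicked m s
          ≈⟨ trans (when-*ʳ (k ≤ᵇ s) (θ^ (m ∸ s) * e) (Unpicked m s))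
                   (*-congʳ (when-*ʳ (k ≤ᵇ s) (θ^ (m ∸ s)) e)) ⟨
        when (k ≤ᵇ s) (secondBestAt m s) ∎
        where
        a = when (k ≤ᵇ s) (θ^ (m ∸ s))
        e = insertionWeight (suc m) (s <ᵇ_)

    unpickedBlock : ℕ → ℕ → Carrier
    unpickedBlock s e = T₁ s k * B s e * Pfact e

    secondBestAt-+ : ∀ s e → secondBestAt (s ℕ.+ e) s ≈ θ^ e * P (suc e) * unpickedBlock s e
    secondBestAt-+ s e = *-cong (*-cong (reflexive (cong θ^ (ℕₚ.m+n∸m≡n s e))) (insertionWeight-> s e))
      (trans (Unpicked-+ s e) (*-congʳ (*-congʳ (Unpicked-diagonal≈T₁ s))))

    unpickedBlock-suc : ∀ s e → unpickedBlock s (suc e) ≈ P (suc (s ℕ.+ e)) * unpickedBlock s e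
    unpickedBlock-suc s e = begin
      T₁ s k * B s (suc e) * (P (suc e) * Pfact e)
        ≈⟨ solve 4 (λ a b c d → a :* b :* (c :* d) := a :* (b :* c) :* d)
                   ≈-refl (T₁ s k) (B s (suc e)) (P (suc e)) (Pfact e) ⟩
      T₁ s k * (B s (suc e) * P (suc e)) * Pfact e
        ≈⟨ *-congʳ (*-congˡ (B-sucʳ-P s e)) ⟩
      T₁ s k * (P (suc (s ℕ.+ e)) * B s e) * Pfact e
        ≈⟨ solve 4 (λ a b c d → a :* (b :* c) :* d := b :* (a :* c :* d))
                   ≈-refl (T₁ s k) (P (suc (s ℕ.+ e))) (B s e) (Pfact e) ⟩
      P (suc (s ℕ.+ e)) * unpickedBlock s e ∎

    W₁*-antidiagonal : ∀ t →
      W₁* (suc (suc (k ℕ.+ t))) k ≈ antidiagonal t (λ j e → θ^ e * P (suc e) * unpickedBlock (k ℕ.+ j) e)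
    W₁*-antidiagonal t = begin
      W₁* (suc (suc (k ℕ.+ t))) k
        ≈⟨ W₁*-suc-suc (k ℕ.+ t) ⟩
      sumUpTo (suc (k ℕ.+ t)) (λ s → when (k ≤ᵇ s) (secondBestAt (k ℕ.+ t) s))
        ≡⟨ cong (λ n → sumUpTo n (λ s → when (k ≤ᵇ s) (secondBestAt (k ℕ.+ t) s)))
                (≡.sym (ℕₚ.+-suc k t)) ⟩
      sumUpTo (k ℕ.+ suc t) (λ s → when (k ≤ᵇ s) (secondBestAt (k ℕ.+ t) s))
        ≈⟨ sumUpTo-when-≤ᵇ k (suc t) (secondBestAt (k ℕ.+ t)) ⟩
      sumUpTo (suc t) (λ j → secondBestAt (k ℕ.+ t) (k ℕ.+ j))
        ≈⟨ sumUpTo≈antidiagonal t _ _ closed ⟩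
      antidiagonal t (λ j e → θ^ e * P (suc e) * unpickedBlock (k ℕ.+ j) e) ∎
      where
      closed : ∀ j e → j ℕ.+ e ≡ t →
        secondBestAt (k ℕ.+ t) (k ℕ.+ j) ≈ θ^ e * P (suc e) * unpickedBlock (k ℕ.+ j) e
      closed j e refl = trans (reflexive (cong (λ n → secondBestAt n (k ℕ.+ j)) (≡.sym (ℕₚ.+-assoc k j e))))
                              (secondBestAt-+ (k ℕ.+ j) e)

    sumTerm : ℕ → ℕ → Carrier
    sumTerm N i = θ^ (N ∸ i ∸ 1) * T₁ (i ∸ 1) k * B (i ∸ 1) (N ∸ i ∸ 1) * Pfact (N ∸ i ∸ 1)

    sumRange-sumTerm : ∀ t → let N = suc (suc (suc (k ℕ.+ t))) in
      sumRange (k ℕ.+ 1) (N ∸ 1) (sumTerm N) ≈ antidiagonal (suc t) (λ j e → θ^ e * unpickedBlock (k ℕ.+ j) e)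
    sumRange-sumTerm t = trans (sumRange≈sumUpTo (k ℕ.+ 1) (suc (suc (k ℕ.+ t))) (suc (suc t)) (sumTerm N) length≡)
      (sumUpTo≈antidiagonal (suc t) _ _ term)
      where
      N = suc (suc (suc (k ℕ.+ t)))
      k+1+j≡ : ∀ j → k ℕ.+ 1 ℕ.+ j ≡ suc (k ℕ.+ j)
      k+1+j≡ j = ≡.trans (ℕₚ.+-assoc k 1 j) (ℕₚ.+-suc k j)
      N≡ : ∀ j e → j ℕ.+ e ≡ suc t → suc (k ℕ.+ j) ℕ.+ suc e ≡ N
      N≡ j e j+e≡ = cong suc (≡.trans (ℕₚ.+-suc (k ℕ.+ j) e)
        (cong suc (≡.trans (ℕₚ.+-assoc k j e) (≡.trans (cong (k ℕ.+_) j+e≡) (ℕₚ.+-suc k t)))))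
      length≡ : suc (suc (suc (k ℕ.+ t))) ∸ (k ℕ.+ 1) ≡ suc (suc t)
      length≡ = ≡.trans (cong (_∸ (k ℕ.+ 1)) (≡.sym (≡.trans (k+1+j≡ (suc (suc t)))
                          (cong suc (≡.trans (ℕₚ.+-suc k (suc t)) (cong suc (ℕₚ.+-suc k t)))))))
                        (ℕₚ.m+n∸m≡n (k ℕ.+ 1) (suc (suc t)))
      term : ∀ j e → j ℕ.+ e ≡ suc t → sumTerm N (k ℕ.+ 1 ℕ.+ j) ≈ θ^ e * unpickedBlock (k ℕ.+ j) e
      term j e j+e≡ = trans (reflexive (cong₂ (λ a b → θ^ b * T₁ a k * B a b * Pfact b) i∸1≡ N∸i∸1≡))
        (solve 4 (λ x y z w → x :* y :* z :* w := x :* (y :* z :* w))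
               ≈-refl (θ^ e) (T₁ (k ℕ.+ j) k) (B (k ℕ.+ j) e) (Pfact e))
        where
        i∸1≡ : k ℕ.+ 1 ℕ.+ j ∸ 1 ≡ k ℕ.+ j
        i∸1≡ = cong (_∸ 1) (k+1+j≡ j)
        N∸i∸1≡ : N ∸ (k ℕ.+ 1 ℕ.+ j) ∸ 1 ≡ e
        N∸i∸1≡ = cong (_∸ 1) (≡.trans (cong (N ∸_) (k+1+j≡ j))
          (≡.trans (cong (_∸ suc (k ℕ.+ j)) (≡.sym (N≡ j e j+e≡))) (ℕₚ.m+n∸m≡n (suc (k ℕ.+ j)) (suc e))))

    RecurrenceAt : ℕ → Set ℓ
    RecurrenceAt N = W₁* N k ≈ (θ^ 2 * P (N ∸ 2)) * W₁* (N ∸ 1) k + sumRange (k ℕ.+ 1) (N ∸ 1) (sumTerm N)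

    W₁*-recurrence-+ : ∀ t → RecurrenceAt (suc (suc (suc (k ℕ.+ t))))
    W₁*-recurrence-+ t = begin
      W₁* (suc (suc (suc (k ℕ.+ t)))) k
        ≡⟨ cong (λ n → W₁* (suc (suc n)) k) (≡.sym (ℕₚ.+-suc k t)) ⟩
      W₁* (suc (suc (k ℕ.+ suc t))) k
        ≈⟨ W₁*-antidiagonal (suc t) ⟩
      antidiagonal (suc t) (λ j e → θ^ e * P (suc e) * unpickedBlock (k ℕ.+ j) e)
        ≈⟨ antidiagonal-P-split t (P (suc (k ℕ.+ t))) (unpickedBlock ∘ (k ℕ.+_)) block-suc ⟩
      (θ^ 2 * P (suc (k ℕ.+ t))) * antidiagonal t (λ j e → θ^ e * P (suc e) * unpickedBlock (k ℕ.+ j) e)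
        + antidiagonal (suc t) (λ j e → θ^ e * unpickedBlock (k ℕ.+ j) e)
        ≈⟨ +-cong (*-congˡ (W₁*-antidiagonal t)) (sumRange-sumTerm t) ⟨
      (θ^ 2 * P (suc (k ℕ.+ t))) * W₁* (suc (suc (k ℕ.+ t))) k
        + sumRange (k ℕ.+ 1) (suc (suc (k ℕ.+ t))) (sumTerm (suc (suc (suc (k ℕ.+ t))))) ∎
      where
      block-suc : ∀ j e → j ℕ.+ e ≡ t →
        unpickedBlock (k ℕ.+ j) (suc e) ≈ P (suc (k ℕ.+ t)) * unpickedBlock (k ℕ.+ j) e
      block-suc j e refl =
        trans (unpickedBlock-suc (k ℕ.+ j) e) (*-congʳ (reflexive (cong (P ∘ suc) (ℕₚ.+-assoc k j e))))

    W₁*-recurrence : ∀ N → k ℕ.+ 3 ≤ N → RecurrenceAt N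
    W₁*-recurrence N k+3≤N with ℕₚ.m≤n⇒∃[o]m+o≡n k+3≤N
    ... | t , refl = ≡.subst RecurrenceAt (≡.sym k+3+t≡) (W₁*-recurrence-+ t)
      where
      k+3+t≡ : k ℕ.+ 3 ℕ.+ t ≡ suc (suc (suc (k ℕ.+ t)))
      k+3+t≡ = ≡.trans (ℕₚ.+-assoc k 3 t) (≡.trans (ℕₚ.+-comm k (3 ℕ.+ t)) (cong (suc ∘ suc ∘ suc) (ℕₚ.+-comm t k)))

    W₁*-initial₂ : W₁* (k ℕ.+ 2) k ≈ Pfact k
    W₁*-initial₂ = begin
      W₁* (k ℕ.+ 2) k                      ≡⟨ cong (λ n → W₁* n k) (≡.trans (ℕₚ.+-suc k 1) (cong suc (ℕₚ.+-suc k 0))) ⟩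
      W₁* (suc (suc (k ℕ.+ 0))) k          ≈⟨ W₁*-antidiagonal 0 ⟩
      1# * P 1 * unpickedBlock (k ℕ.+ 0) 0 ≡⟨ cong (λ n → 1# * P 1 * unpickedBlock n 0) (ℕₚ.+-identityʳ k) ⟩
      1# * P 1 * (T₁ k k * B k 0 * 1#)     ≈⟨ *-cong (*-congˡ P-1) (*-congʳ (*-cong T₁-diagonal (B-zeroʳ k))) ⟩
      1# * 1# * (Pfact k * 1# * 1#)        ≈⟨ solve 1 (λ x → con 1 :* con 1 :* (x :* con 1 :* con 1) := x) ≈-refl _ ⟩
      Pfact k                              ∎
      where
      T₁-diagonal : T₁ k k ≈ Pfact k
      T₁-diagonal = trans (sym (Unpicked-diagonal≈T₁ k)) (Unpicked-rejected k ℕₚ.≤-refl)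

  W₁*-initial₁ : ∀ k → W₁* (k ℕ.+ 1) k ≈ 0#
  W₁*-initial₁ zero     = +-identityʳ 0#
  W₁*-initial₁ (suc k′) = begin
    W₁* (suc k′ ℕ.+ 1) (suc k′) ≡⟨ cong (λ n → W₁* (suc n) (suc k′)) (ℕₚ.+-comm k′ 1) ⟩
    W₁* (suc (suc k′)) (suc k′) ≈⟨ W₁*-suc-suc (suc k′) k′ ⟩
    sumUpTo (suc k′) (λ s → when (suc k′ ≤ᵇ s) (secondBestAt (suc k′) k′ s))
      ≈⟨ sumUpTo-zero (suc k′) _ (λ s s≤k′ →
           reflexive (cong (λ b → when b (secondBestAt (suc k′) k′ s)) (≤ᵇ-false s≤k′))) ⟩
    0#                          ∎

theorem10 : ∀ {c ℓ} (R : CommutativeSemiring c ℓ) (θ : CommutativeSemiring.Carrier R) →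
    let open CommutativeSemiring R
        open Weighted R θ
    in (∀ (k N : ℕ) → 1 ≤ k → k ℕ.+ 3 ≤ N →
          W₁* N k ≈ (θ^ 2 * P (N ∸ 2)) * W₁* (N ∸ 1) k
                    + sumRange (k ℕ.+ 1) (N ∸ 1)
                        (λ i → θ^ (N ∸ i ∸ 1) * T₁ (i ∸ 1) k * B (i ∸ 1) (N ∸ i ∸ 1)
                               * Pfact (N ∸ i ∸ 1)))
       × (∀ (k : ℕ) → 1 ≤ k → W₁* (k ℕ.+ 1) k ≈ 0#)
       × (∀ (k : ℕ) → 1 ≤ k → W₁* (k ℕ.+ 2) k ≈ Pfact k)
theorem10 R θ =
  (λ k N _ → W₁*-recurrence k N) , (λ k _ → W₁*-initial₁ k) , (λ k _ → W₁*-initial₂ k)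
  where open Recurrence R θ
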